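{- Let $G$ be a triangle-free, non-bipartite graph with $r(G)=6$. Then $G$ contains, as an induced subgraph, the graph obtained from the $5$-cycle $C_5$ by attaching one pendant vertex to one of its vertices.
   Context: All graphs are finite and simple. The rank $r(G)$ of a graph is the rank of its adjacency matrix. -}

module Defs where

open import Data.Nat using (ℕ; zero; suc)
open import Data.Fin using (Fin; toℕ)
open import Data.Bool using (Bool; true; false; _∨_)
open import Data.Rational using (ℚ; 0ℚ; 1ℚ; _+_; _*_)
open import Data.Product using (Σ; _×_; ∃; ∃-syntax)
open import Relation.Binary.PropositionalEquality using (_≡_; _≢_)
open import Relation.Nullary using (¬_)
open import Data.Empty using (⊥)
open import Function.Definitions using (Injective)

record Graph (n : ℕ) : Set where
  field
    adj   : Fin n → Fin n → Bool
    sym   : ∀ i j → adj i j ≡ adj j i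
    irrefl : ∀ i → adj i i ≡ false
open Graph public

adjMatrix : ∀ {n} → Graph n → Fin n → Fin n → ℚ
adjMatrix G i j with adj G i j
... | true  = 1ℚ
... | false = 0ℚ

∑ : ∀ k → (Fin k → ℚ) → ℚ
∑ zero    f = 0ℚ
∑ (suc k) f = f Fin.zero + ∑ k (λ i → f (Fin.suc i))

LinIndep : ∀ {k n} → (Fin k → Fin n → ℚ) → Set
LinIndep {k} {n} v =
  (c : Fin k → ℚ) → (∀ j → ∑ k (λ i → c i * v i j) ≡ 0ℚ) → ∀ i → c i ≡ 0ℚ

-- Row rank over ℚ (equivalently over ℝ) of an n×n matrix:
-- HasRank A r  iff  the maximum number of linearly independent rows is r.
HasRank : ∀ {n} → (Fin n → Fin n → ℚ) → ℕ → Set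
HasRank {n} A r =
  (Σ (Fin r → Fin n) λ σ → LinIndep (λ i → A (σ i)))
  × (∀ (σ : Fin (suc r) → Fin n) → ¬ LinIndep (λ i → A (σ i)))

Rank : ∀ {n} → Graph n → ℕ → Set
Rank G r = HasRank (adjMatrix G) r

TriangleFree : ∀ {n} → Graph n → Set
TriangleFree G = ∀ i j k → adj G i j ≡ true → adj G j k ≡ true → adj G i k ≡ true → ⊥

Bipartite : ∀ {n} → Graph n → Set
Bipartite {n} G = Σ (Fin n → Bool) λ col → ∀ i j → adj G i j ≡ true → col i ≢ col j

edgeℕ : ℕ → ℕ → Bool
edgeℕ 0 1 = true
edgeℕ 1 2 = true
edgeℕ 2 3 = true
edgeℕ 3 4 = true
edgeℕ 4 0 = true
edgeℕ 0 5 = true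
edgeℕ _ _ = false

c5pendant : Fin 6 → Fin 6 → Bool
c5pendant i j = edgeℕ (toℕ i) (toℕ j) ∨ edgeℕ (toℕ j) (toℕ i)

InducedSub : ∀ {n m} → (Fin m → Fin m → Bool) → Graph n → Set
InducedSub {n} {m} h G =
  Σ (Fin m → Fin n) λ f → Injective _≡_ _≡_ f × (∀ i j → adj G (f i) (f j) ≡ h i j)

module Submission where

-- (1) A parity-labelled spanning forest, built pair by pair, either
-- 2-colours G or closes an odd walk.  (2) Shortening an odd closed walk along
-- chords gives an induced odd cycle; it is not C3 (triangle-free), not C7 and
-- not longer (C7 and the path on 8 vertices have 7 independent rows), so it
-- is a C5.  (3) Without an induced C5 + pendant, every vertex either misses
-- the C5 or is a twin of a cycle vertex, and the vertices missing it are
-- isolated (two adjacent ones would induce C5 + K2, with 7 independent rows),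
-- so every row is zero or a row of the C5 and the rank is at most 5.  Since
-- containing C5 + pendant is decidable, the lemma follows.

open import Defs hiding (sym)
open import Data.Nat as ℕ using (ℕ; zero; suc; _≤_; _<_; z≤n; s≤s; parity)
open import Data.Nat.Induction using (<-rec)
open import Data.Nat.DivMod using (_mod_)
open import Data.Nat.Tactic.RingSolver using (solve-∀)
import Data.Nat.Properties as ℕ
open import Data.Fin as Fin using (Fin; zero; suc; toℕ)
open import Data.Fin.Properties
  using (any?; all?; pigeonhole; <⇒≢; ¬∀⟶∃¬; toℕ<n; toℕ≤pred[n]; toℕ-inject≤)
  renaming (_≟_ to _≟ᶠ_)
open import Data.Bool using (Bool; true; false; if_then_else_; _∨_)
open import Data.Bool.Properties using (∨-identityʳ; ¬-not; ⇔→≡) renaming (_≟_ to _≟ᵇ_)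
open import Function.Bundles using (mk⇔)
open import Data.Rational using (ℚ; 0ℚ; 1ℚ; _+_; _*_; -_) renaming (_<_ to _<ℚ_)
import Data.Rational.Properties as ℚ
open import Data.Product using (Σ; Σ-syntax; ∃; _×_; _,_; proj₁; proj₂)
open import Data.Sum using (_⊎_; inj₁; inj₂; swap)
open import Data.Empty using (⊥; ⊥-elim)
open import Data.Unit using (⊤; tt)
open import Data.Vec.Functional using (_∷_; head; tail; updateAt)
open import Data.Vec.Functional.Properties using (updateAt-updates; updateAt-minimal)
open import Data.List as List using (List; cartesianProduct; allFin)
open import Data.List.Membership.Propositional using (_∈_)
open import Data.List.Membership.Propositional.Properties using (∈-allFin; ∈-cartesianProduct⁺)
open import Data.List.Relation.Unary.Any using (here; there)
open import Data.Parity as ℙ using (Parity; 0ℙ; 1ℙ)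
import Data.Parity.Properties as ℙ
open import Function using (_∘_)
open import Relation.Nullary using (¬_; Dec; yes; no; does)
open import Relation.Nullary.Decidable
  using (map′; decidable-stable; ¬?; dec-true; dec-false; toWitness; _⊎-dec_; _×-dec_; _→-dec_)
open import Relation.Unary using (Decidable)
open import Relation.Binary.PropositionalEquality
open import Relation.Binary.Definitions using (tri<; tri≈; tri>)
open import Agda.Builtin.FromNat using (Number; fromNat)
import Data.Nat.Literals as ℕ-Literals
import Data.Fin.Literals as Fin-Literals
open import Algebra.Bundles using (AbelianGroup)
open import Algebra.Properties.Group (AbelianGroup.group ℚ.+-0-abelianGroup)
  using (inverseˡ-unique; ⁻¹-involutive)
open import Algebra.Properties.CommutativeSemigroup
  (AbelianGroup.commutativeSemigroup ℚ.+-0-abelianGroup) using (interchange)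

-- Numeric literals for natural numbers and for positions in Fin n (the
-- bound side condition of a closed Fin literal reduces to ⊤).
instance
  ℕ-number : Number ℕ
  ℕ-number = ℕ-Literals.number
  Fin-number : ∀ {n} → Number (Fin n)
  Fin-number {n} = Fin-Literals.number n
  literal-bound : ⊤
  literal-bound = tt

true≢false : true ≢ false
true≢false ()

Extensional : ∀ {m} {A : Set} → ((Fin m → A) → Set) → Set
Extensional P = ∀ {f g} → (∀ i → f i ≡ g i) → P f → P g

Searchable : Set → Set₁
Searchable A = ∀ {P : A → Set} → Decidable P → Dec (∃ P)

bool-searchable : Searchable Bool
bool-searchable P? with P? false | P? true
... | yes p | _     = yes (false , p)
... | no _  | yes p = yes (true , p)
... | no ¬f | no ¬t = no λ { (false , p) → ¬f p ; (true , p) → ¬t p }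

search-maps : ∀ m {A} → Searchable A → ∀ {P : (Fin m → A) → Set}
            → Extensional P → Decidable P → Dec (∃ P)
search-maps zero    search ext P? =
  map′ (λ p → _ , p) (λ (f , p) → ext (λ ()) p) (P? (λ ()))
search-maps (suc m) search {P} ext P? =
  map′ (λ (x , g , p) → x ∷ g , p)
       (λ (f , p) → head f , tail f , ext (λ { zero → refl ; (suc i) → refl }) p)
       (search λ x → search-maps m search (λ e → ext λ { zero → refl ; (suc i) → e i })
                                           (λ g → P? (x ∷ g)))

all-maps? : ∀ m {A} → Searchable A → ∀ {P : (Fin m → A) → Set}
          → Extensional P → Decidable P → Dec (∀ f → P f)
all-maps? m search {P} ext P? with search-maps m search (λ e ¬p → ¬p ∘ ext (sym ∘ e)) (¬? ∘ P?)
... | yes (f , ¬p) = no λ all → ¬p (all f)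
... | no ¬∃       = yes λ f → decidable-stable (P? f) (λ ¬p → ¬∃ (f , ¬p))

toℚ : Bool → ℚ
toℚ true  = 1ℚ
toℚ false = 0ℚ

adjMatrix-toℚ : ∀ {n} (G : Graph n) i j → adjMatrix G i j ≡ toℚ (adj G i j)
adjMatrix-toℚ G i j with adj G i j
... | true  = refl
... | false = refl

∑-cong : ∀ k {f g : Fin k → ℚ} → (∀ i → f i ≡ g i) → ∑ k f ≡ ∑ k g
∑-cong zero    e = refl
∑-cong (suc k) e = cong₂ _+_ (e zero) (∑-cong k (e ∘ suc))

∑-+ : ∀ k (f g : Fin k → ℚ) → ∑ k (λ l → f l + g l) ≡ ∑ k f + ∑ k g
∑-+ zero    f g = sym (ℚ.+-identityˡ 0ℚ)
∑-+ (suc k) f g = trans (cong (f zero + g zero +_) (∑-+ k (f ∘ suc) (g ∘ suc)))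
                        (interchange (f zero) (g zero) (∑ k (f ∘ suc)) (∑ k (g ∘ suc)))

∑-neg : ∀ k (f : Fin k → ℚ) → ∑ k (λ l → - f l) ≡ - ∑ k f
∑-neg zero    f = refl
∑-neg (suc k) f = trans (cong (- f zero +_) (∑-neg k (f ∘ suc)))
                        (sym (ℚ.neg-distrib-+ (f zero) (∑ k (f ∘ suc))))

δ : ∀ {k} → Fin k → Fin k → ℚ
δ i l = toℚ (does (i ≟ᶠ l))

∑-δ : ∀ k (i : Fin k) (v : Fin k → ℚ) → ∑ k (λ l → δ i l * v l) ≡ v i
∑-δ (suc k) zero    v = begin
  1ℚ * v zero + ∑ k (λ l → 0ℚ * v (suc l))
    ≡⟨ cong₂ _+_ (ℚ.*-identityˡ (v zero)) (vanish k (v ∘ suc)) ⟩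
  v zero + 0ℚ                              ≡⟨ ℚ.+-identityʳ (v zero) ⟩
  v zero                                   ∎
  where
  open ≡-Reasoning
  vanish : ∀ k (w : Fin k → ℚ) → ∑ k (λ l → 0ℚ * w l) ≡ 0ℚ
  vanish zero    w = refl
  vanish (suc k) w = trans (cong₂ _+_ (ℚ.*-zeroˡ (w zero)) (vanish k (w ∘ suc))) (ℚ.+-identityˡ 0ℚ)
∑-δ (suc k) (suc i) v =
  trans (cong₂ _+_ (ℚ.*-zeroˡ (v zero)) (∑-δ k i (v ∘ suc))) (ℚ.+-identityˡ (v (suc i)))

δ-diag : ∀ {k} (i : Fin k) → δ i i ≡ 1ℚ
δ-diag i = cong toℚ (dec-true (i ≟ᶠ i) refl)

δ-off : ∀ {k} {i j : Fin k} → i ≢ j → δ i j ≡ 0ℚ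
δ-off {i = i} {j} i≢j = cong toℚ (dec-false (i ≟ᶠ j) i≢j)

1≢0 : 1ℚ ≢ 0ℚ
1≢0 ()

zero-row-dependent : ∀ {k n} (v : Fin k → Fin n → ℚ) i → (∀ z → v i z ≡ 0ℚ) → ¬ LinIndep v
zero-row-dependent {k} v i zero-row indep =
  1≢0 (trans (sym (δ-diag i)) (indep (δ i) (λ z → trans (∑-δ k i (λ l → v l z)) (zero-row z)) i))

equal-rows-dependent : ∀ {k n} (v : Fin k → Fin n → ℚ) {i j} → i ≢ j
                     → (∀ z → v i z ≡ v j z) → ¬ LinIndep v
equal-rows-dependent {k} v {i} {j} i≢j same indep = 1≢0 (trans (sym c-i) (indep c relation i))
  where
  c : Fin k → ℚ
  c l = δ i l + - δ j l
  c-i : c i ≡ 1ℚ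
  c-i = trans (cong₂ (λ a b → a + - b) (δ-diag i) (δ-off (i≢j ∘ sym))) (ℚ.+-identityʳ 1ℚ)
  relation : ∀ z → ∑ k (λ l → c l * v l z) ≡ 0ℚ
  relation z = begin
    ∑ k (λ l → c l * v l z)
      ≡⟨ ∑-cong k (λ l → trans (ℚ.*-distribʳ-+ (v l z) (δ i l) (- δ j l))
                               (cong (δ i l * v l z +_) (sym (ℚ.neg-distribˡ-* (δ j l) (v l z))))) ⟩
    ∑ k (λ l → δ i l * v l z + - (δ j l * v l z))
      ≡⟨ ∑-+ k _ _ ⟩
    ∑ k (λ l → δ i l * v l z) + ∑ k (λ l → - (δ j l * v l z))
      ≡⟨ cong₂ _+_ (∑-δ k i (λ l → v l z)) (trans (∑-neg k _) (cong -_ (∑-δ k j (λ l → v l z)))) ⟩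
    v i z + - v j z
      ≡⟨ cong (_+ - v j z) (same z) ⟩
    v j z + - v j z
      ≡⟨ ℚ.+-inverseʳ (v j z) ⟩
    0ℚ ∎
    where open ≡-Reasoning

first-or-all : ∀ {m} {P Q : Fin m → Set} → (∀ i → P i ⊎ Q i) → (∃ Q) ⊎ (∀ i → P i)
first-or-all {zero}  pq = inj₂ (λ ())
first-or-all {suc m} pq with pq zero | first-or-all (pq ∘ suc)
... | inj₂ q | _             = inj₁ (zero , q)
... | inj₁ p | inj₁ (i , q)  = inj₁ (suc i , q)
... | inj₁ p | inj₂ ps       = inj₂ λ { zero → p ; (suc i) → ps i }

few-rows-dependent : ∀ {k n} (v : Fin (suc k) → Fin n → ℚ) (w : Fin k → Fin n → ℚ)
                   → (∀ i → (Σ[ l ∈ Fin k ] ∀ z → v i z ≡ w l z) ⊎ (∀ z → v i z ≡ 0ℚ))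
                   → ¬ LinIndep v
few-rows-dependent {k} v w classes with first-or-all classes
... | inj₁ (i , zero-row) = zero-row-dependent v i zero-row
... | inj₂ copies with pigeonhole (ℕ.n<1+n k) (proj₁ ∘ copies)
...   | i , j , i<j , same-class = equal-rows-dependent v (<⇒≢ i<j) λ z →
          trans (proj₂ (copies i) z) (trans (cong (λ l → w l z) same-class) (sym (proj₂ (copies j) z)))

selected : ∀ k → (Fin k → ℚ) → (Fin k → Bool) → ℚ
selected zero    c b = 0ℚ
selected (suc k) c b =
  if b zero then c zero + selected k (c ∘ suc) (b ∘ suc) else selected k (c ∘ suc) (b ∘ suc)

∑-selected : ∀ k (c : Fin k → ℚ) (b : Fin k → Bool) → ∑ k (λ i → c i * toℚ (b i)) ≡ selected k c b
∑-selected zero    c b = refl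
∑-selected (suc k) c b with b zero
... | true  = cong₂ _+_ (ℚ.*-identityʳ (c zero)) (∑-selected k (c ∘ suc) (b ∘ suc))
... | false = trans (cong₂ _+_ (ℚ.*-zeroʳ (c zero)) (∑-selected k (c ∘ suc) (b ∘ suc)))
                    (ℚ.+-identityˡ _)

IndependentPattern : ∀ {k m} → (Fin k → Fin m → Bool) → Set
IndependentPattern H = LinIndep (λ i j → toℚ (H i j))

-- For a concrete pattern the column equations reduce to sums of selected
-- coefficients; solving those shows independence.
independent-by-selection : ∀ {k m} (H : Fin k → Fin m → Bool)
  → (∀ c → (∀ j → selected k c (λ i → H i j) ≡ 0ℚ) → ∀ i → c i ≡ 0ℚ)
  → IndependentPattern H
independent-by-selection {k} H solve c relation =
  solve c λ j → trans (sym (∑-selected k c (λ i → H i j))) (relation j)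

pattern-rows-independent : ∀ {n k m} (G : Graph n) (σ : Fin k → Fin n) (τ : Fin m → Fin n)
  (H : Fin k → Fin m → Bool) → (∀ i j → adj G (σ i) (τ j) ≡ H i j)
  → IndependentPattern H → LinIndep (λ i → adjMatrix G (σ i))
pattern-rows-independent {k = k} G σ τ H realised indep c relation = indep c λ j →
  trans (∑-cong k λ i → cong (c i *_) (trans (cong toℚ (sym (realised i j)))
                                              (sym (adjMatrix-toℚ G (σ i) (τ j)))))
        (relation (τ j))

-- The column equations of the patterns below have one or two terms.
single : ∀ x → x + 0ℚ ≡ 0ℚ → x ≡ 0ℚ
single x e = trans (sym (ℚ.+-identityʳ x)) e

pair : ∀ x y → x + (y + 0ℚ) ≡ 0ℚ → x ≡ - y
pair x y e = inverseˡ-unique x y (trans (cong (x +_) (sym (ℚ.+-identityʳ y))) e)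

pair′ : ∀ x y → x + (y + 0ℚ) ≡ 0ℚ → y ≡ - x
pair′ x y e = pair y x (begin
  y + (x + 0ℚ) ≡⟨ cong (y +_) (ℚ.+-identityʳ x) ⟩
  y + x        ≡⟨ ℚ.+-comm y x ⟩
  x + y        ≡⟨ cong (x +_) (sym (ℚ.+-identityʳ y)) ⟩
  x + (y + 0ℚ) ≡⟨ e ⟩
  0ℚ           ∎)
  where open ≡-Reasoning

_⨾_ : ∀ {x y z} → x ≡ - y → y ≡ - z → x ≡ z
_⨾_ {z = z} p q = trans p (trans (cong -_ q) (⁻¹-involutive z))

vanishes : ∀ {x y} → x ≡ - y → y ≡ 0ℚ → x ≡ 0ℚ
vanishes p refl = p

self-negative : ∀ x → x ≡ - x → x ≡ 0ℚ
self-negative x e with ℚ.<-cmp x 0ℚ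
... | tri≈ _ x≡0 _ = x≡0
... | tri< x<0 _ _ = ⊥-elim (ℚ.<-asym x<0 (subst (0ℚ <ℚ_) (sym e) (ℚ.neg-antimono-< x<0)))
... | tri> _ _ x>0 = ⊥-elim (ℚ.<-asym x>0 (subst (_<ℚ 0ℚ) (sym e) (ℚ.neg-antimono-< x>0)))

Fin7-cases : ∀ {P : Fin 7 → Set} → P 0 → P 1 → P 2 → P 3 → P 4 → P 5 → P 6 → ∀ i → P i
Fin7-cases p₀ p₁ p₂ p₃ p₄ p₅ p₆ zero                                    = p₀
Fin7-cases p₀ p₁ p₂ p₃ p₄ p₅ p₆ (suc zero)                              = p₁
Fin7-cases p₀ p₁ p₂ p₃ p₄ p₅ p₆ (suc (suc zero))                        = p₂
Fin7-cases p₀ p₁ p₂ p₃ p₄ p₅ p₆ (suc (suc (suc zero)))                  = p₃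
Fin7-cases p₀ p₁ p₂ p₃ p₄ p₅ p₆ (suc (suc (suc (suc zero))))            = p₄
Fin7-cases p₀ p₁ p₂ p₃ p₄ p₅ p₆ (suc (suc (suc (suc (suc zero)))))      = p₅
Fin7-cases p₀ p₁ p₂ p₃ p₄ p₅ p₆ (suc (suc (suc (suc (suc (suc zero)))))) = p₆

PathAdjacent : ℕ → ℕ → Set
PathAdjacent i j = suc i ≡ j ⊎ suc j ≡ i

Wraps : ℕ → ℕ → ℕ → Set
Wraps L i j = (i ≡ 0 × suc j ≡ L) ⊎ (j ≡ 0 × suc i ≡ L)

CycleAdjacent : ℕ → ℕ → ℕ → Set
CycleAdjacent L i j = PathAdjacent i j ⊎ Wraps L i j

path? : ∀ i j → Dec (PathAdjacent i j)
path? i j = (suc i ℕ.≟ j) ⊎-dec (suc j ℕ.≟ i)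

wraps? : ∀ L i j → Dec (Wraps L i j)
wraps? L i j = ((i ℕ.≟ 0) ×-dec (suc j ℕ.≟ L)) ⊎-dec ((j ℕ.≟ 0) ×-dec (suc i ℕ.≟ L))

Path : ℕ → ℕ → Bool
Path i j = does (path? i j)

adjacent? : ∀ L i j → Dec (CycleAdjacent L i j)
adjacent? L i j = path? i j ⊎-dec wraps? L i j

Cyc : ℕ → ℕ → ℕ → Bool
Cyc L i j = does (adjacent? L i j)

Cyc≡Path : ∀ L i j → suc i < L → suc j < L → Cyc L i j ≡ Path i j
Cyc≡Path L i j i<L j<L = trans (cong (Path i j ∨_) (dec-false (wraps? L i j) no-wrap)) (∨-identityʳ _)
  where
  no-wrap : ¬ Wraps L i j
  no-wrap (inj₁ (_ , j+1≡L)) = ℕ.<-irrefl j+1≡L j<L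
  no-wrap (inj₂ (_ , i+1≡L)) = ℕ.<-irrefl i+1≡L i<L

mismatch-edge : ∀ {L i j b} → b ≢ Cyc L i j → ¬ CycleAdjacent L i j → b ≡ true
mismatch-edge {L} {i} {j} differ apart =
  ¬-not λ b≡false → differ (trans b≡false (sym (dec-false (adjacent? L i j) apart)))

cycle-adjacent-sym : ∀ {L i j} → CycleAdjacent L i j → CycleAdjacent L j i
cycle-adjacent-sym (inj₁ path) = inj₁ (swap path)
cycle-adjacent-sym (inj₂ wrap) = inj₂ (swap wrap)

cycle : ∀ L → Fin L → Fin L → Bool
cycle L i j = Cyc L (toℕ i) (toℕ j)

C5 : Fin 5 → Fin 5 → Bool
C5 = cycle 5

_◁_ : ∀ {m} → (Fin m → Bool) → (Fin m → Fin m → Bool) → Fin (suc m) → Fin (suc m) → Bool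
(r ◁ h) zero    zero    = false
(r ◁ h) zero    (suc j) = r j
(r ◁ h) (suc i) zero    = r i
(r ◁ h) (suc i) (suc j) = h i j

-- C5 together with a disjoint edge (vertices 0 - 1, cycle on 2, …, 6).
C5+K2 : Fin 7 → Fin 7 → Bool
C5+K2 = (true ∷ λ _ → false) ◁ ((λ _ → false) ◁ C5)

-- The adjacency matrix of C7 is nonsingular: around the odd cycle the
-- column equations force c₀ = - c₀.
C7-independent : IndependentPattern (cycle 7)
C7-independent = independent-by-selection (cycle 7) λ c col →
  let c₀≡c₄ = pair (c 0) (c 2) (col 1) ⨾ pair (c 2) (c 4) (col 3)
      c₄≡c₁ = pair (c 4) (c 6) (col 5) ⨾ pair′ (c 1) (c 6) (col 0)
      c₁≡c₅ = pair (c 1) (c 3) (col 2) ⨾ pair (c 3) (c 5) (col 4)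
      c₅≡-c₀ = pair′ (c 0) (c 5) (col 6)
      c₀≡0  = self-negative (c 0) (trans c₀≡c₄ (trans c₄≡c₁ (trans c₁≡c₅ c₅≡-c₀)))
      c₅≡0  = vanishes c₅≡-c₀ c₀≡0
      c₃≡0  = vanishes (pair (c 3) (c 5) (col 4)) c₅≡0
      c₁≡0  = vanishes (pair (c 1) (c 3) (col 2)) c₃≡0
      c₆≡0  = vanishes (pair′ (c 1) (c 6) (col 0)) c₁≡0
      c₄≡0  = vanishes (pair (c 4) (c 6) (col 5)) c₆≡0
      c₂≡0  = vanishes (pair (c 2) (c 4) (col 3)) c₄≡0
  in Fin7-cases c₀≡0 c₁≡0 c₂≡0 c₃≡0 c₄≡0 c₅≡0 c₆≡0

-- The rows 0, …, 6 of the path on 8 vertices are independent: solve from the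
-- ends of the path inwards.
P8-rows-independent : IndependentPattern {7} {8} (λ i j → Path (toℕ i) (toℕ j))
P8-rows-independent = independent-by-selection (λ i j → Path (toℕ i) (toℕ j)) λ c col →
  let c₁≡0 = single (c 1) (col 0)
      c₆≡0 = single (c 6) (col 7)
      c₅≡0 = single (c 5) (col 6)
      c₄≡0 = vanishes (pair (c 4) (c 6) (col 5)) c₆≡0
      c₃≡0 = vanishes (pair (c 3) (c 5) (col 4)) c₅≡0
      c₂≡0 = vanishes (pair (c 2) (c 4) (col 3)) c₄≡0
      c₀≡0 = vanishes (pair (c 0) (c 2) (col 1)) c₂≡0
  in Fin7-cases c₀≡0 c₁≡0 c₂≡0 c₃≡0 c₄≡0 c₅≡0 c₆≡0

-- C5 + K2 has independent rows: the edge part is trivial, the C5 part is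
-- the odd-cycle argument again.
C5+K2-independent : IndependentPattern C5+K2
C5+K2-independent = independent-by-selection C5+K2 λ c col →
  let c₂≡c₆ = pair (c 2) (c 4) (col 3) ⨾ pair (c 4) (c 6) (col 5)
      c₆≡c₅ = pair′ (c 3) (c 6) (col 2) ⨾ pair (c 3) (c 5) (col 4)
      c₅≡-c₂ = pair′ (c 2) (c 5) (col 6)
      c₂≡0  = self-negative (c 2) (trans c₂≡c₆ (trans c₆≡c₅ c₅≡-c₂))
      c₅≡0  = vanishes c₅≡-c₂ c₂≡0
      c₃≡0  = vanishes (pair (c 3) (c 5) (col 4)) c₅≡0
      c₆≡0  = vanishes (pair′ (c 3) (c 6) (col 2)) c₃≡0
      c₄≡0  = vanishes (pair (c 4) (c 6) (col 5)) c₆≡0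
  in Fin7-cases (single (c 0) (col 1)) (single (c 1) (col 0)) c₂≡0 c₃≡0 c₄≡0 c₅≡0 c₆≡0

module Walks {n} (G : Graph n) where

  data Walk : Fin n → Fin n → ℕ → Set where
    stay : ∀ {u} → Walk u u 0
    _▸_  : ∀ {u v w ℓ} → adj G u v ≡ true → Walk v w ℓ → Walk u w (suc ℓ)

  infixr 5 _▸_ _++_

  _++_ : ∀ {u v w k l} → Walk u v k → Walk v w l → Walk u w (k ℕ.+ l)
  stay    ++ q = q
  (e ▸ p) ++ q = e ▸ (p ++ q)

  reverse : ∀ {u v ℓ} → Walk u v ℓ → Walk v u ℓ
  reverse stay = stay
  reverse {ℓ = suc ℓ} (_▸_ {u} {v} e p) =
    subst (Walk _ u) (ℕ.+-comm ℓ 1) (reverse p ++ (trans (Graph.sym G v u) e ▸ stay))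

  OddClosedWalk : Set
  OddClosedWalk = Σ[ v ∈ Fin n ] Σ[ ℓ ∈ ℕ ] Walk v v ℓ × parity ℓ ≡ 1ℙ

  parity-suc : ∀ ℓ → parity (suc ℓ) ≡ 1ℙ ℙ.+ parity ℓ
  parity-suc = ℙ.+-homo-+ 1

  record Forest (E : List (Fin n × Fin n)) : Set where
    field
      root   : Fin n → Fin n
      colour : Fin n → Parity
      branch : ∀ v → Σ[ ℓ ∈ ℕ ] Walk (root v) v ℓ × parity ℓ ≡ colour v
      proper : ∀ {u w} → (u , w) ∈ E → adj G u w ≡ true → root u ≡ root w × colour u ≢ colour w

  trivial-forest : Forest List.[]
  trivial-forest = record
    { root = λ v → v ; colour = λ _ → 0ℙ ; branch = λ v → 0 , stay , refl ; proper = λ () }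

  extend : ∀ {E u w} (F : Forest E) → let open Forest F in
           (adj G u w ≡ true → root u ≡ root w × colour u ≢ colour w) → Forest ((u , w) List.∷ E)
  extend F new = record
    { root = root ; colour = colour ; branch = branch
    ; proper = λ { (here refl) → new ; (there p) → proper p } }
    where open Forest F

  -- An edge inside one tree joining vertices of equal colour closes an odd
  -- walk: root u ⇝ u - w ⇝ root w.
  close-odd : ∀ {E} (F : Forest E) {u w} → let open Forest F in
              adj G u w ≡ true → root u ≡ root w → colour u ≡ colour w → OddClosedWalk
  close-odd F {u} {w} uw same-root same-colour
    with branch u | branch w
    where open Forest F
  ... | ℓu , pu , cu | ℓw , pw , cw =
    root u , ℓu ℕ.+ suc ℓw ,
    subst (λ r → Walk (root u) r _) (sym same-root) (pu ++ uw ▸ reverse pw) , odd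
    where
    open Forest F
    p+1+p≡1 : ∀ p → p ℙ.+ (1ℙ ℙ.+ p) ≡ 1ℙ
    p+1+p≡1 0ℙ = refl
    p+1+p≡1 1ℙ = refl
    odd : parity (ℓu ℕ.+ suc ℓw) ≡ 1ℙ
    odd = begin
      parity (ℓu ℕ.+ suc ℓw)         ≡⟨ ℙ.+-homo-+ ℓu (suc ℓw) ⟩
      parity ℓu ℙ.+ parity (suc ℓw)
        ≡⟨ cong₂ ℙ._+_ cu (trans (parity-suc ℓw) (cong (1ℙ ℙ.+_) cw)) ⟩
      colour u ℙ.+ (1ℙ ℙ.+ colour w) ≡⟨ cong (λ c → c ℙ.+ (1ℙ ℙ.+ colour w)) same-colour ⟩
      colour w ℙ.+ (1ℙ ℙ.+ colour w) ≡⟨ p+1+p≡1 (colour w) ⟩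
      1ℙ                             ∎
      where open ≡-Reasoning

  -- An edge u - w between two trees: the tree of w is re-rooted at the root
  -- of u, through the edge, with colours shifted to stay proper.
  module Merge {E} (F : Forest E) {u w} (uw : adj G u w ≡ true)
               (different-root : Forest.root F u ≢ Forest.root F w) where
    open Forest F

    moves : ∀ x → Dec (root x ≡ root w)
    moves x = root x ≟ᶠ root w

    shift : Parity → Parity
    shift c = colour u ℙ.+ (1ℙ ℙ.+ colour w ℙ.+ c)

    root′ : Fin n → Fin n
    root′ x with moves x
    ... | yes _ = root u
    ... | no  _ = root x

    colour′ : Fin n → Parity
    colour′ x with moves x
    ... | yes _ = shift (colour x)
    ... | no  _ = colour x

    -- The new branch of a moved vertex x: root u ⇝ u - w ⇝ root w = root x ⇝ x.
    branch′ : ∀ x → Σ[ ℓ ∈ ℕ ] Walk (root′ x) x ℓ × parity ℓ ≡ colour′ x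
    branch′ x with moves x
    ... | no _ = branch x
    ... | yes x-moves with branch u | branch w | branch x
    ...   | ℓu , pu , cu | ℓw , pw , cw | ℓx , px , cx =
      ℓu ℕ.+ (suc ℓw ℕ.+ ℓx) , pu ++ uw ▸ reverse pw ++ subst (λ r → Walk r x ℓx) x-moves px ,
      (begin
        parity (ℓu ℕ.+ (suc ℓw ℕ.+ ℓx))
          ≡⟨ ℙ.+-homo-+ ℓu _ ⟩
        parity ℓu ℙ.+ parity (suc ℓw ℕ.+ ℓx)
          ≡⟨ cong (parity ℓu ℙ.+_) (ℙ.+-homo-+ (suc ℓw) ℓx) ⟩
        parity ℓu ℙ.+ (parity (suc ℓw) ℙ.+ parity ℓx)
          ≡⟨ cong (λ p → parity ℓu ℙ.+ (p ℙ.+ parity ℓx)) (parity-suc ℓw) ⟩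
        parity ℓu ℙ.+ (1ℙ ℙ.+ parity ℓw ℙ.+ parity ℓx)
          ≡⟨ cong₂ (λ a b → a ℙ.+ (1ℙ ℙ.+ b ℙ.+ parity ℓx)) cu cw ⟩
        shift (parity ℓx)
          ≡⟨ cong shift cx ⟩
        shift (colour x) ∎)
      where open ≡-Reasoning

    shift-injective : ∀ {c d} → shift c ≡ shift d → c ≡ d
    shift-injective = ℙ.+-cancelˡ-≡ (1ℙ ℙ.+ colour w) _ _ ∘ ℙ.+-cancelˡ-≡ (colour u) _ _

    -- After the shift, w gets the colour opposite to u.
    shift-flips : ∀ c d → c ≢ c ℙ.+ (1ℙ ℙ.+ d ℙ.+ d)
    shift-flips 0ℙ 0ℙ ()
    shift-flips 0ℙ 1ℙ ()
    shift-flips 1ℙ 0ℙ ()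
    shift-flips 1ℙ 1ℙ ()

    -- Old edges lie in one tree, which moves as a whole or not at all.
    proper′ : ∀ {y z} → (y , z) ∈ (u , w) List.∷ E → adj G y z ≡ true
            → root′ y ≡ root′ z × colour′ y ≢ colour′ z
    proper′ (here refl) _ with moves u | moves w
    ... | yes u-moves | _         = ⊥-elim (different-root u-moves)
    ... | no _        | no w-stays = ⊥-elim (w-stays refl)
    ... | no _        | yes _      = refl , shift-flips (colour u) (colour w)
    proper′ {y} {z} (there p) yz with proper p yz | moves y | moves z
    ... | same , differ | yes _     | yes _      = refl , differ ∘ shift-injective
    ... | same , differ | no _      | no _       = same , differ
    ... | same , differ | yes y-moves | no z-stays = ⊥-elim (z-stays (trans (sym same) y-moves))
    ... | same , differ | no y-stays  | yes z-moves = ⊥-elim (y-stays (trans same z-moves))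

    merged : Forest ((u , w) List.∷ E)
    merged = record { root = root′ ; colour = colour′ ; branch = branch′ ; proper = proper′ }

  add-pair : ∀ {E} u w → Forest E → OddClosedWalk ⊎ Forest ((u , w) List.∷ E)
  add-pair u w F with adj G u w in uw | Forest.root F u ≟ᶠ Forest.root F w
                    | Forest.colour F u ℙ.≟ Forest.colour F w
  ... | false | _                 | _               = inj₂ (extend F λ uw′ → ⊥-elim (true≢false (trans (sym uw′) uw)))
  ... | true  | yes same-root     | no different    = inj₂ (extend F λ _ → same-root , different)
  ... | true  | yes same-root     | yes same-colour = inj₁ (close-odd F uw same-root same-colour)
  ... | true  | no different-root | _               = inj₂ (Merge.merged F uw different-root)

  forest-or-odd-walk : ∀ E → OddClosedWalk ⊎ Forest E
  forest-or-odd-walk List.[]              = inj₂ trivial-forest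
  forest-or-odd-walk ((u , w) List.∷ E) with forest-or-odd-walk E
  ... | inj₁ odd = inj₁ odd
  ... | inj₂ F   = add-pair u w F

  -- A non-bipartite graph has an odd closed walk: otherwise the forest for
  -- all pairs of vertices yields a proper 2-colouring.
  odd-closed-walk : ¬ Bipartite G → OddClosedWalk
  odd-closed-walk non-bipartite with forest-or-odd-walk (cartesianProduct (allFin n) (allFin n))
  ... | inj₁ odd = odd
  ... | inj₂ F   = ⊥-elim (non-bipartite (isOdd ∘ colour , λ i j e →
                      colour-differs i j e ∘ isOdd-injective))
    where
    open Forest F
    isOdd : Parity → Bool
    isOdd 0ℙ = false
    isOdd 1ℙ = true
    isOdd-injective : ∀ {p q} → isOdd p ≡ isOdd q → p ≡ q
    isOdd-injective {0ℙ} {0ℙ} _ = refl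
    isOdd-injective {1ℙ} {1ℙ} _ = refl
    colour-differs : ∀ i j → adj G i j ≡ true → colour i ≢ colour j
    colour-differs i j = proj₂ ∘ proper (∈-cartesianProduct⁺ (∈-allFin i) (∈-allFin j))

Induces : ∀ {n m} → Graph n → (Fin m → Fin n) → (Fin m → Fin m → Bool) → Set
Induces G f h = ∀ i j → adj G (f i) (f j) ≡ h i j

RankBelow7 : ∀ {n} → Graph n → Set
RankBelow7 {n} G = ∀ (σ : Fin 7 → Fin n) → ¬ LinIndep (λ i → adjMatrix G (σ i))

module OddCycles {n} (G : Graph n) where
  open Walks G

  symmetric : ∀ {u v} → adj G u v ≡ true → adj G v u ≡ true
  symmetric {u} {v} e = trans (Graph.sym G v u) e

  -- w traverses the closed walk w 0 - w 1 - ⋯ - w m - w 0 of length suc m.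
  ClosedWalk : ℕ → (ℕ → Fin n) → Set
  ClosedWalk m w = (∀ i → i < m → adj G (w i) (w (suc i)) ≡ true) × adj G (w m) (w 0) ≡ true

  OddClosed : ℕ → Set
  OddClosed m = parity (suc m) ≡ 1ℙ × Σ (ℕ → Fin n) (ClosedWalk m)

  -- The vertex at position i of a walk (positions past the end stay there).
  position : ∀ {u v ℓ} → Walk u v ℓ → ℕ → Fin n
  position (stay {u})    _       = u
  position (_▸_ {u} e p) zero    = u
  position (e ▸ p)       (suc i) = position p i

  position-start : ∀ {u v ℓ} (p : Walk u v ℓ) → position p 0 ≡ u
  position-start stay    = refl
  position-start (e ▸ p) = refl

  position-end : ∀ {u v ℓ} (p : Walk u v ℓ) → position p ℓ ≡ v
  position-end stay    = refl
  position-end (e ▸ p) = position-end p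

  position-step : ∀ {u v ℓ} (p : Walk u v ℓ) i → i < ℓ → adj G (position p i) (position p (suc i)) ≡ true
  position-step (_▸_ e p) zero    _       = subst (λ v → adj G _ v ≡ true) (sym (position-start p)) e
  position-step (e ▸ p)   (suc i) (s≤s i<ℓ) = position-step p i i<ℓ

  positional : OddClosedWalk → Σ ℕ OddClosed
  positional (v , zero  , p , ())
  positional (v , suc m , p , odd) =
    m , odd , position p , (λ i i<m → position-step p i (ℕ.m<n⇒m<1+n i<m)) , closing
    where
    closing : adj G (position p m) (position p 0) ≡ true
    closing = subst (λ u → adj G (position p m) u ≡ true)
                    (trans (position-end p) (sym (position-start p))) (position-step p m (ℕ.n<1+n m))

  inner-cycle : ∀ {m w} i k → ClosedWalk m w → i ℕ.+ k ≤ m → adj G (w (i ℕ.+ k)) (w i) ≡ true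
              → ClosedWalk k (λ t → w (i ℕ.+ t))
  inner-cycle {w = w} i k (steps , _) i+k≤m back =
    (λ t t<k → subst (λ x → adj G (w (i ℕ.+ t)) (w x) ≡ true) (sym (ℕ.+-suc i t))
                     (steps (i ℕ.+ t) (ℕ.<-≤-trans (ℕ.+-monoʳ-< i t<k) i+k≤m))) ,
    subst (λ x → adj G (w (i ℕ.+ k)) (w x) ≡ true) (sym (ℕ.+-identityʳ i)) back

  jump : (ℕ → Fin n) → ℕ → ℕ → ℕ → Fin n
  jump w i j k with k ℕ.≤? i
  ... | yes _ = w k
  ... | no  _ = w (j ℕ.+ (k ℕ.∸ suc i))

  jump-before : ∀ w i j k → k ≤ i → jump w i j k ≡ w k
  jump-before w i j k k≤i with k ℕ.≤? i
  ... | yes _  = refl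
  ... | no k≰i = ⊥-elim (k≰i k≤i)

  jump-after : ∀ w i j k → jump w i j (suc i ℕ.+ k) ≡ w (j ℕ.+ k)
  jump-after w i j k with suc i ℕ.+ k ℕ.≤? i
  ... | yes past = ⊥-elim (ℕ.n≮n i (ℕ.≤-trans (ℕ.m≤m+n (suc i) k) past))
  ... | no _     = cong (λ t → w (j ℕ.+ t)) (ℕ.m+n∸m≡n (suc i) k)

  -- The positions 0, …, i, j, …, j + s of a closed walk: the chord w i - w j
  -- replaces the segment between i and j.
  outer-cycle : ∀ {w} i j s → i < j → ClosedWalk (j ℕ.+ s) w → adj G (w i) (w j) ≡ true
              → ClosedWalk (i ℕ.+ suc s) (jump w i j)
  outer-cycle {w} i j s i<j (steps , closing) chord = steps′ , closing′
    where
    closing′ : adj G (jump w i j (i ℕ.+ suc s)) (jump w i j 0) ≡ true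
    closing′ = subst₂ (λ x y → adj G x y ≡ true)
                 (sym (trans (cong (jump w i j) (ℕ.+-suc i s)) (jump-after w i j s)))
                 (sym (jump-before w i j 0 z≤n)) closing
    steps′ : ∀ k → k < i ℕ.+ suc s → adj G (jump w i j k) (jump w i j (suc k)) ≡ true
    steps′ k k<end with ℕ.<-cmp k i
    ... | tri< k<i _ _ =
      subst₂ (λ x y → adj G x y ≡ true) (sym (jump-before w i j k (ℕ.<⇒≤ k<i)))
             (sym (jump-before w i j (suc k) k<i))
             (steps k (ℕ.<-≤-trans k<i (ℕ.≤-trans (ℕ.<⇒≤ i<j) (ℕ.m≤m+n j s))))
    ... | tri≈ _ refl _ =
      subst₂ (λ x y → adj G x y ≡ true) (sym (jump-before w k j k ℕ.≤-refl))
             (sym (trans (cong (jump w k j) (sym (ℕ.+-identityʳ (suc k)))) (jump-after w k j 0)))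
             (subst (λ y → adj G (w k) (w y) ≡ true) (sym (ℕ.+-identityʳ j)) chord)
    ... | tri> _ _ i<k with ℕ.m≤n⇒∃[o]m+o≡n i<k
    ...   | t , refl =
      subst₂ (λ x y → adj G x y ≡ true) (sym (jump-after w i j t))
             (sym (trans (cong (jump w i j) (sym (ℕ.+-suc (suc i) t))) (jump-after w i j (suc t))))
             (subst (λ y → adj G (w (j ℕ.+ t)) (w y) ≡ true) (sym (ℕ.+-suc j t))
                    (steps (j ℕ.+ t) (ℕ.+-monoʳ-< j t<s)))
      where
      t<s : t < s
      t<s = ℕ.s<s⁻¹ (ℕ.+-cancelˡ-< i (suc t) (suc s) (subst (_< i ℕ.+ suc s) (sym (ℕ.+-suc i t)) k<end))

  odd-part : ∀ p q → p ℙ.+ q ≡ 1ℙ → p ≡ 1ℙ ⊎ q ≡ 1ℙ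
  odd-part 1ℙ _  _  = inj₁ refl
  odd-part 0ℙ 1ℙ _  = inj₂ refl

  -- A chord from position i to position j = i + 2 + d of an odd closed walk
  -- of length j + s + 1, other than the closing edge, splits the walk into an
  -- inner and an outer closed walk of total length two more.  One of them is
  -- odd, and both are strictly shorter.
  shortcut : ∀ {w} i d s → let j = i ℕ.+ suc (suc d) in
             ClosedWalk (j ℕ.+ s) w → parity (suc (j ℕ.+ s)) ≡ 1ℙ → 1 ≤ i ℕ.+ s
             → adj G (w i) (w j) ≡ true → Σ[ m′ ∈ ℕ ] m′ < j ℕ.+ s × OddClosed m′
  shortcut {w} i d s cw odd nontrivial chord
    with odd-part (parity (suc (suc (suc d)))) (parity (suc (i ℕ.+ suc s))) total
    where
    total : parity (suc (suc (suc d))) ℙ.+ parity (suc (i ℕ.+ suc s)) ≡ 1ℙ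
    total = trans (sym (ℙ.+-homo-+ (suc (suc (suc d))) _)) (trans (cong parity (lengths d i s)) odd)
      where
      lengths : ∀ d i s → suc (suc (suc d)) ℕ.+ suc (i ℕ.+ suc s) ≡ suc (suc (suc (i ℕ.+ suc (suc d) ℕ.+ s)))
      lengths = solve-∀
  ... | inj₁ inner-odd =
    suc (suc d) , inner-shorter , inner-odd , (λ t → w (i ℕ.+ t)) ,
    inner-cycle i (suc (suc d)) cw (ℕ.m≤m+n _ s) (symmetric chord)
    where
    inner-shorter : suc (suc d) < i ℕ.+ suc (suc d) ℕ.+ s
    inner-shorter = subst (suc (suc (suc d)) ≤_) (rearrange i d s) (ℕ.+-monoˡ-≤ (suc (suc d)) nontrivial)
      where
      rearrange : ∀ i d s → i ℕ.+ s ℕ.+ suc (suc d) ≡ i ℕ.+ suc (suc d) ℕ.+ s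
      rearrange = solve-∀
  ... | inj₂ outer-odd =
    i ℕ.+ suc s , outer-shorter , outer-odd , jump w i _ ,
    outer-cycle i (i ℕ.+ suc (suc d)) s (ℕ.m<m+n i (s≤s z≤n)) cw chord
    where
    outer-shorter : i ℕ.+ suc s < i ℕ.+ suc (suc d) ℕ.+ s
    outer-shorter = subst (suc (i ℕ.+ suc s) ≤_) (rearrange i d s) (ℕ.m≤m+n _ d)
      where
      rearrange : ∀ i d s → suc (i ℕ.+ suc s) ℕ.+ d ≡ i ℕ.+ suc (suc d) ℕ.+ s
      rearrange = solve-∀

  walk-edge : ∀ {m w} → ClosedWalk m w → ∀ i j → i ≤ m → j ≤ m
            → CycleAdjacent (suc m) i j → adj G (w i) (w j) ≡ true
  walk-edge (steps , _)       i j _   j≤m (inj₁ (inj₁ refl))         = steps i j≤m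
  walk-edge (steps , _)       i j i≤m _   (inj₁ (inj₂ refl))         = symmetric (steps j i≤m)
  walk-edge (_ , closing)     i j _   _   (inj₂ (inj₁ (refl , refl))) = symmetric closing
  walk-edge (_ , closing)     i j _   _   (inj₂ (inj₂ (refl , refl))) = closing

  chord-shortens : ∀ {m w} → ClosedWalk m w → parity (suc m) ≡ 1ℙ → ∀ i j → i < j → j ≤ m
                 → ¬ CycleAdjacent (suc m) i j → adj G (w i) (w j) ≡ true
                 → Σ[ m′ ∈ ℕ ] m′ < m × OddClosed m′
  chord-shortens cw odd i j i<j j≤m apart chord with ℕ.m≤n⇒∃[o]m+o≡n i<j
  ... | zero , i+1≡j = ⊥-elim (apart (inj₁ (inj₁ (trans (sym (ℕ.+-identityʳ (suc i))) i+1≡j))))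
  ... | suc d , i+1+d≡j with trans (ℕ.+-suc i (suc d)) i+1+d≡j | ℕ.m≤n⇒∃[o]m+o≡n j≤m
  ...   | refl | s , refl = shortcut i d s cw odd (positive i s not-closing) chord
    where
    positive : ∀ i s → ¬ (i ≡ 0 × s ≡ 0) → 1 ≤ i ℕ.+ s
    positive (suc _) _       _       = s≤s z≤n
    positive zero    (suc _) _       = s≤s z≤n
    positive zero    zero    nonzero = ⊥-elim (nonzero (refl , refl))
    not-closing : ¬ (i ≡ 0 × s ≡ 0)
    not-closing (i≡0 , s≡0) =
      apart (inj₂ (inj₁ (i≡0 , cong suc (sym (trans (cong (_ ℕ.+_) s≡0) (ℕ.+-identityʳ _))))))

  mismatch-shortens : ∀ {m w} → ClosedWalk m w → parity (suc m) ≡ 1ℙ → ∀ i j → i ≤ m → j ≤ m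
                    → adj G (w i) (w j) ≢ Cyc (suc m) i j → Σ[ m′ ∈ ℕ ] m′ < m × OddClosed m′
  mismatch-shortens {m} {w} cw odd i j i≤m j≤m differ with adjacent? (suc m) i j
  ... | yes adjacent =
    ⊥-elim (differ (trans (walk-edge cw i j i≤m j≤m adjacent)
                          (sym (dec-true (adjacent? (suc m) i j) adjacent))))
  ... | no apart with ℕ.<-cmp i j
  ...   | tri< i<j _ _  = chord-shortens cw odd i j i<j j≤m apart (mismatch-edge differ apart)
  ...   | tri≈ _ refl _ = ⊥-elim (true≢false (trans (sym (mismatch-edge differ apart)) (irrefl G (w i))))
  ...   | tri> _ _ j<i  = chord-shortens cw odd j i j<i i≤m (apart ∘ cycle-adjacent-sym)
                                         (symmetric (mismatch-edge differ apart))

  InducedCycle : ℕ → (ℕ → Fin n) → Set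
  InducedCycle L w = ∀ (i j : Fin L) → adj G (w (toℕ i)) (w (toℕ j)) ≡ cycle L i j

  InducedOddCycle : Set
  InducedOddCycle = Σ[ m ∈ ℕ ] parity (suc m) ≡ 1ℙ × Σ (ℕ → Fin n) (InducedCycle (suc m))

  induced-odd-cycle : ∀ m → OddClosed m → InducedOddCycle
  induced-odd-cycle = <-rec (λ m → OddClosed m → InducedOddCycle) step
    where
    step : ∀ m → (∀ {m′} → m′ < m → OddClosed m′ → InducedOddCycle) → OddClosed m → InducedOddCycle
    step m shorter (odd , w , cw)
      with all? (λ i → all? λ j → adj G (w (toℕ i)) (w (toℕ j)) ≟ᵇ cycle (suc m) i j)
    ... | yes induced = m , odd , w , induced
    ... | no not-induced =
      let i , not-induced-at-i = ¬∀⟶∃¬ _ _ (λ i → all? λ j → _ ≟ᵇ _) not-induced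
          j , differ           = ¬∀⟶∃¬ _ _ (λ j → _ ≟ᵇ _) not-induced-at-i
          m′ , m′<m , shorter-walk =
            mismatch-shortens cw odd (toℕ i) (toℕ j) (toℕ≤pred[n] i) (toℕ≤pred[n] j) differ
      in shorter m′<m shorter-walk

  -- In a triangle-free non-bipartite graph of rank at most 6, a shortest odd
  -- cycle is an induced C5: C3 is a triangle, C7 has rank 7, and a longer
  -- induced cycle contains an induced path on 8 vertices, whose first 7
  -- rows are independent.
  induced-C5 : TriangleFree G → RankBelow7 G → ¬ Bipartite G → Σ (Fin 5 → Fin n) λ a → Induces G a C5
  induced-C5 triangle-free rank≤6 non-bipartite
    with positional (odd-closed-walk non-bipartite)
  ... | m , odd-walk with induced-odd-cycle m odd-walk
  ... | 0 , _ , w , cyc = ⊥-elim (true≢false (trans (sym (cyc 0 0)) (irrefl G (w 0))))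
  ... | 2 , _ , w , cyc = ⊥-elim (triangle-free (w 0) (w 1) (w 2) (cyc 0 1) (cyc 1 2) (cyc 0 2))
  ... | 4 , _ , w , cyc = w ∘ toℕ , cyc
  ... | 6 , _ , w , cyc =
    ⊥-elim (rank≤6 (w ∘ toℕ) (pattern-rows-independent G (w ∘ toℕ) (w ∘ toℕ) (cycle 7) cyc C7-independent))
  ... | suc (suc (suc (suc (suc (suc (suc (suc k))))))) , _ , w , cyc =
    ⊥-elim (rank≤6 (w ∘ toℕ) (pattern-rows-independent G (w ∘ toℕ) (w ∘ toℕ) _ path P8-rows-independent))
    where
    L : ℕ
    L = 9 ℕ.+ k
    path : ∀ (i : Fin 7) (j : Fin 8) → adj G (w (toℕ i)) (w (toℕ j)) ≡ Path (toℕ i) (toℕ j)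
    path i j = trans (subst₂ (λ a b → adj G (w a) (w b) ≡ Cyc L a b) (toℕ-inject≤ i _) (toℕ-inject≤ j _)
                               (cyc (Fin.inject≤ i (ℕ.<⇒≤ 7<L)) (Fin.inject≤ j (ℕ.<⇒≤ 8<L))))
                     (Cyc≡Path L (toℕ i) (toℕ j) (below i 7<L) (below j 8<L))
      where
      7<L : 7 < L
      7<L = ℕ.m≤m+n 8 (1 ℕ.+ k)
      8<L : 8 < L
      8<L = ℕ.m≤m+n 9 k
      below : ∀ {p} (x : Fin p) → p < L → suc (toℕ x) < L
      below x p<L = ℕ.≤-<-trans (toℕ<n x) p<L
  ... | 1 , () , _
  ... | 3 , () , _
  ... | 5 , () , _
  ... | 7 , () , _

module Copies {n} (G : Graph n) where

  induces-◁ : ∀ {m} {f : Fin m → Fin n} {h x} {r : Fin m → Bool}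
            → Induces G f h → (∀ i → adj G x (f i) ≡ r i) → Induces G (x ∷ f) (r ◁ h)
  induces-◁ {x = x} copy row zero    zero    = irrefl G x
  induces-◁ {x = x} copy row zero    (suc j) = row j
  induces-◁ {f = f} {x = x} copy row (suc i) zero = trans (Graph.sym G (f i) x) (row i)
  induces-◁ copy row (suc i) (suc j) = copy i j

  induces-∘ : ∀ {k m} {f : Fin m → Fin n} {h : Fin m → Fin m → Bool} (π : Fin k → Fin m)
            → Induces G f h → Induces G (f ∘ π) (λ i j → h (π i) (π j))
  induces-∘ π copy i j = copy (π i) (π j)

  adj-update : ∀ {m} (f : Fin m → Fin n) k x z i
             → adj G z (updateAt f k (λ _ → x) i) ≡ (if does (i ≟ᶠ k) then adj G z x else adj G z (f i))
  adj-update f k x z i with i ≟ᶠ k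
  ... | yes refl = cong (adj G z) (updateAt-updates k {λ _ → x} f)
  ... | no i≢k   = cong (adj G z) (updateAt-minimal i k {λ _ → x} f i≢k)

  copy-sym : ∀ {m} {f : Fin m → Fin n} {h : Fin m → Fin m → Bool} → Induces G f h → ∀ i j → h i j ≡ h j i
  copy-sym {f = f} copy i j = trans (sym (copy i j)) (trans (Graph.sym G (f i) (f j)) (copy j i))

  copy-irrefl : ∀ {m} {f : Fin m → Fin n} {h : Fin m → Fin m → Bool} → Induces G f h → ∀ i → h i i ≡ false
  copy-irrefl {f = f} copy i = trans (sym (copy i i)) (irrefl G (f i))

  induces-update : ∀ {m} {f : Fin m → Fin n} {h : Fin m → Fin m → Bool} → Induces G f h
                 → ∀ k x → (∀ i → adj G x (f i) ≡ h k i) → Induces G (updateAt f k (λ _ → x)) h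
  induces-update {f = f} {h} copy k x row i j with i ≟ᶠ k | j ≟ᶠ k
  ... | yes refl | yes refl =
    trans (cong₂ (adj G) (updateAt-updates k {λ _ → x} f) (updateAt-updates k {λ _ → x} f))
          (trans (irrefl G x) (sym (copy-irrefl copy k)))
  ... | yes refl | no j≢k   =
    trans (cong₂ (adj G) (updateAt-updates k {λ _ → x} f) (updateAt-minimal j k {λ _ → x} f j≢k))
          (row j)
  ... | no i≢k   | yes refl =
    trans (cong₂ (adj G) (updateAt-minimal i k {λ _ → x} f i≢k) (updateAt-updates k {λ _ → x} f))
          (trans (Graph.sym G (f i) x) (trans (row i) (copy-sym copy k i)))
  ... | no i≢k   | no j≢k   =
    trans (cong₂ (adj G) (updateAt-minimal i k {λ _ → x} f i≢k) (updateAt-minimal j k {λ _ → x} f j≢k))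
          (copy i j)

TwinFree : ∀ {m} → (Fin m → Fin m → Bool) → Set
TwinFree h = ∀ i j → (∀ k → h k i ≡ h k j) → i ≡ j

-- Every copy of a twin-free pattern is injective, hence an induced subgraph.
twin-free-copy : ∀ {n m} {G : Graph n} {f : Fin m → Fin n} {h : Fin m → Fin m → Bool}
               → TwinFree h → Induces G f h → InducedSub h G
twin-free-copy {G = G} {f} {h} twin-free copy = f , injective , copy
  where
  injective : ∀ {i j} → f i ≡ f j → i ≡ j
  injective {i} {j} fi≡fj =
    twin-free i j λ k → trans (sym (copy k i)) (trans (cong (adj G (f k)) fi≡fj) (copy k j))

opaque
  induced-sub? : ∀ {n m} {h : Fin m → Fin m → Bool} → TwinFree h → (G : Graph n) → Dec (InducedSub h G)
  induced-sub? {m = m} {h} twin-free G =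
    map′ (λ (f , copy) → twin-free-copy {G = G} twin-free copy) (λ (f , _ , copy) → f , copy)
         (search-maps m any? respects (λ f → all? λ i → all? λ j → adj G (f i) (f j) ≟ᵇ h i j))
    where
    respects : Extensional (λ f → Induces G f h)
    respects f≗g copy i j = trans (sym (cong₂ (adj G) (f≗g i) (f≗g j))) (copy i j)

IndependentInC5 : (Fin 5 → Bool) → Set
IndependentInC5 q = ∀ i j → C5 i j ≡ true → q i ≡ true → q j ≡ false

IndependentShape : (Fin 5 → Bool) → Set
IndependentShape q = (∀ i → q i ≡ false) ⊎ (Σ[ m ∈ Fin 5 ] ∀ i → q i ≡ does (i ≟ᶠ m))
                   ⊎ (Σ[ k ∈ Fin 5 ] ∀ i → q i ≡ C5 k i)

-- Facts about C5 and C5 + pendant, each established by evaluating a decision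
-- procedure on all cases.  They are opaque so that later proofs never
-- unfold these evaluations.
opaque
  rotate : Fin 5 → Fin 5 → Fin 5
  rotate m i = (toℕ m ℕ.+ toℕ i) mod 5

  rotate-automorphism : ∀ m i j → C5 (rotate m i) (rotate m j) ≡ C5 i j
  rotate-automorphism = toWitness {a? = all? λ m → all? λ i → all? λ j →
    C5 (rotate m i) (rotate m j) ≟ᵇ C5 i j} _

  rotate-origin : ∀ m i → does (rotate m i ≟ᶠ m) ≡ does (i ≟ᶠ 0)
  rotate-origin = toWitness {a? = all? λ m → all? λ i → does (rotate m i ≟ᶠ m) ≟ᵇ does (i ≟ᶠ 0)} _

  -- Position i of C5 + pendant is position shift i of the pattern with the
  -- pendant vertex placed first.
  shift : Fin 6 → Fin 6
  shift i = (toℕ i ℕ.+ 1) mod 6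

  pendant-first : ∀ i j → ((λ k → does (k ≟ᶠ 0)) ◁ C5) (shift i) (shift j) ≡ c5pendant i j
  pendant-first = toWitness {a? = all? λ i → all? λ j →
    ((λ k → does (k ≟ᶠ 0)) ◁ C5) (shift i) (shift j) ≟ᵇ c5pendant i j} _

  c5pendant-twin-free : TwinFree c5pendant
  c5pendant-twin-free = toWitness {a? = all? λ i → all? λ j →
    all? (λ k → c5pendant k i ≟ᵇ c5pendant k j) →-dec (i ≟ᶠ j)} _

  C5-independent-sets : ∀ q → IndependentInC5 q → IndependentShape q
  C5-independent-sets = toWitness {a? = all-maps? 5 bool-searchable respects λ q →
    (all? λ i → all? λ j → (C5 i j ≟ᵇ true) →-dec (q i ≟ᵇ true) →-dec (q j ≟ᵇ false)) →-dec
    ((all? λ i → q i ≟ᵇ false) ⊎-dec (any? λ m → all? λ i → q i ≟ᵇ does (i ≟ᶠ m))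
                                ⊎-dec (any? λ k → all? λ i → q i ≟ᵇ C5 k i))} _
    where
    respects : Extensional λ q → IndependentInC5 q → IndependentShape q
    respects q≗r classify independent with
      classify (λ i j e qi → trans (q≗r j) (independent i j e (trans (sym (q≗r i)) qi)))
    ... | inj₁ empty             = inj₁ λ i → trans (sym (q≗r i)) (empty i)
    ... | inj₂ (inj₁ (m , one))  = inj₂ (inj₁ (m , λ i → trans (sym (q≗r i)) (one i)))
    ... | inj₂ (inj₂ (k , nbhd)) = inj₂ (inj₂ (k , λ i → trans (sym (q≗r i)) (nbhd i)))

  C5-avoiding : ∀ j k → (∀ i → C5 k i ≡ true → C5 j i ≡ false) → C5 j k ≡ true
  C5-avoiding = toWitness {a? = all? λ j → all? λ k →
    (all? λ i → (C5 k i ≟ᵇ true) →-dec (C5 j i ≟ᵇ false)) →-dec (C5 j k ≟ᵇ true)} _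

  C5-other-neighbour : ∀ j k → C5 j k ≡ true
    → Σ[ o ∈ Fin 5 ] ∀ i → (if does (i ≟ᶠ k) then false else C5 j i) ≡ does (i ≟ᶠ o)
  C5-other-neighbour = toWitness {a? = all? λ j → all? λ k → (C5 j k ≟ᵇ true) →-dec
    (any? λ o → all? λ i → (if does (i ≟ᶠ k) then false else C5 j i) ≟ᵇ does (i ≟ᶠ o))} _

-- A vertex adjacent to exactly one vertex m of an induced C5 completes an
-- induced C5 + pendant (after rotating m to position 0).
pendant-copy : ∀ {n} {G : Graph n} {b : Fin 5 → Fin n} → Induces G b C5
             → ∀ x m → (∀ i → adj G x (b i) ≡ does (i ≟ᶠ m)) → InducedSub c5pendant G
pendant-copy {G = G} {b} cyc x m row =
  twin-free-copy {G = G} c5pendant-twin-free λ i j → trans (copy i j) (pendant-first i j)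
  where
  open Copies G
  rotated : Induces G (b ∘ rotate m) C5
  rotated i j = trans (cyc _ _) (rotate-automorphism m i j)
  copy : Induces G ((x ∷ b ∘ rotate m) ∘ shift)
                   (λ i j → ((λ k → does (k ≟ᶠ 0)) ◁ C5) (shift i) (shift j))
  copy = induces-∘ shift (induces-◁ rotated λ i → trans (row (rotate m i)) (rotate-origin m i))

-- The structure of a triangle-free graph with an induced C5 but no induced
-- C5 + pendant: every vertex is a twin of a cycle vertex or is isolated.
module BlowUp {n} (G : Graph n) (triangle-free : TriangleFree G) (rank≤6 : RankBelow7 G)
              (no-pendant : ¬ InducedSub c5pendant G) where
  open Copies G

  -- On any induced C5, a vertex has no neighbours or the neighbours of a
  -- cycle vertex: its neighbours form an independent set, not a singleton.
  profile : ∀ {b} → Induces G b C5 → ∀ x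
          → (∀ i → adj G x (b i) ≡ false) ⊎ (Σ[ k ∈ Fin 5 ] ∀ i → adj G x (b i) ≡ C5 k i)
  profile {b} cyc x with C5-independent-sets (λ i → adj G x (b i)) independent
    where
    independent : IndependentInC5 (λ i → adj G x (b i))
    independent i j ij xi = ¬-not λ xj → triangle-free x (b i) (b j) xi (trans (cyc i j) ij) xj
  ... | inj₁ empty           = inj₁ empty
  ... | inj₂ (inj₁ (m , one)) = ⊥-elim (no-pendant (pendant-copy {G = G} cyc x m one))
  ... | inj₂ (inj₂ nbhd)      = inj₂ nbhd

  module _ {a : Fin 5 → Fin n} (cyc : Induces G a C5) where

    Mimics : Fin n → Fin 5 → Set
    Mimics x k = ∀ i → adj G x (a i) ≡ C5 k i

    Isolated : Fin n → Set
    Isolated y = ∀ i → adj G y (a i) ≡ false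

    swapped : ∀ {x k} → Mimics x k → Induces G (updateAt a k (λ _ → x)) C5
    swapped {x} {k} row = induces-update cyc k x row

    -- A neighbour z of a vertex x mimicking a k is a neighbour of a k: if z
    -- missed the cycle it would be a pendant at x, and z misses the neighbours
    -- of a k (triangles), which forces z next to a k.
    twin-right : ∀ {x k} → Mimics x k → ∀ z → adj G x z ≡ true → adj G (a k) z ≡ true
    twin-right {x} {k} row z xz with profile cyc z
    ... | inj₁ isolated = ⊥-elim (no-pendant (pendant-copy {G = G} (swapped row) z k λ i →
            trans (adj-update a k x z i) (at-k i)))
      where
      at-k : ∀ i → (if does (i ≟ᶠ k) then adj G z x else adj G z (a i)) ≡ does (i ≟ᶠ k)
      at-k i with i ≟ᶠ k
      ... | yes _ = trans (Graph.sym G z x) xz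
      ... | no _  = isolated i
    ... | inj₂ (j , z-row) = trans (Graph.sym G (a k) z) (trans (z-row k) (C5-avoiding j k avoids))
      where
      avoids : ∀ i → C5 k i ≡ true → C5 j i ≡ false
      avoids i ki = trans (sym (z-row i)) (¬-not λ zi →
        triangle-free x z (a i) xz zi (trans (row i) ki))

    -- A neighbour z of a k is a neighbour of every x mimicking a k: otherwise,
    -- on the cycle with a k replaced by x, z would have a single neighbour.
    twin-left : ∀ {x k} → Mimics x k → ∀ z → adj G (a k) z ≡ true → adj G x z ≡ true
    twin-left {x} {k} row z kz with adj G x z in xz | profile cyc z
    ... | true  | _ = refl
    ... | false | inj₁ isolated =
      ⊥-elim (true≢false (trans (sym kz) (trans (Graph.sym G (a k) z) (isolated k))))
    ... | false | inj₂ (j , z-row)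
      with C5-other-neighbour j k (trans (sym (z-row k)) (trans (Graph.sym G z (a k)) kz))
    ...   | o , only-o = ⊥-elim (no-pendant (pendant-copy {G = G} (swapped row) z o λ i →
              trans (adj-update a k x z i) (trans (off-k i) (only-o i))))
      where
      off-k : ∀ i → (if does (i ≟ᶠ k) then adj G z x else adj G z (a i))
                  ≡ (if does (i ≟ᶠ k) then false else C5 j i)
      off-k i with i ≟ᶠ k
      ... | yes _ = trans (Graph.sym G z x) xz
      ... | no _  = z-row i

    twin : ∀ {x k} → Mimics x k → ∀ z → adj G x z ≡ adj G (a k) z
    twin row z = ⇔→≡ (mk⇔ (twin-right row z) (twin-left row z))

    isolated-closed : ∀ {y} → Isolated y → ∀ z → adj G y z ≡ true → Isolated z
    isolated-closed {y} y-isolated z yz with profile cyc z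
    ... | inj₁ z-isolated = z-isolated
    ... | inj₂ (j , z-row) =
      ⊥-elim (true≢false (trans (sym (twin-right z-row y (trans (Graph.sym G z y) yz)))
                                (trans (Graph.sym G (a j) y) (y-isolated j))))

    -- Two vertices isolated from the cycle are not adjacent: with the cycle
    -- they would induce C5 + K2, which has 7 independent rows.
    isolated-nonadjacent : ∀ {y z} → Isolated y → Isolated z → adj G y z ≡ true → ⊥
    isolated-nonadjacent {y} {z} y-isolated z-isolated yz =
      rank≤6 (z ∷ y ∷ a) (pattern-rows-independent G _ _ C5+K2 copy C5+K2-independent)
      where
      z-row : ∀ i → adj G z ((y ∷ a) i) ≡ (true ∷ λ _ → false) i
      z-row zero    = trans (Graph.sym G z y) yz
      z-row (suc i) = z-isolated i
      copy : Induces G (z ∷ y ∷ a) C5+K2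
      copy = induces-◁ (induces-◁ cyc y-isolated) z-row

    row-types : ∀ v → (Σ[ k ∈ Fin 5 ] ∀ z → adjMatrix G v z ≡ adjMatrix G (a k) z)
                    ⊎ (∀ z → adjMatrix G v z ≡ 0ℚ)
    row-types v with profile cyc v
    ... | inj₂ (k , row) = inj₁ (k , λ z →
            trans (adjMatrix-toℚ G v z) (trans (cong toℚ (twin row z)) (sym (adjMatrix-toℚ G (a k) z))))
    ... | inj₁ isolated  = inj₂ λ z → trans (adjMatrix-toℚ G v z) (cong toℚ (no-neighbour z))
      where
      no-neighbour : ∀ z → adj G v z ≡ false
      no-neighbour z = ¬-not λ vz → isolated-nonadjacent isolated (isolated-closed isolated z vz) vz

    rank≤5 : ∀ (σ : Fin 6 → Fin n) → ¬ LinIndep (λ i → adjMatrix G (σ i))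
    rank≤5 σ = few-rows-dependent _ (λ k → adjMatrix G (a k)) (row-types ∘ σ)

lemma4p10 : ∀ {n : ℕ} (G : Graph n) → TriangleFree G → ¬ Bipartite G → Rank G 6
          → InducedSub c5pendant G
lemma4p10 G triangle-free non-bipartite ((σ , independent) , rank≤6)
  with induced-sub? c5pendant-twin-free G
... | yes copy       = copy
... | no no-pendant with OddCycles.induced-C5 G triangle-free rank≤6 non-bipartite
...   | a , cyc = ⊥-elim (BlowUp.rank≤5 G triangle-free rank≤6 no-pendant cyc σ independent)
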